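{- For any types $A, B : \Box_i$, there is an equivalence of types \[(A \simeq B) \;\simeq\; \Sigma R : A \to B \to \Box_i.\ \mathrm{isUMap}(R) \times \mathrm{isUMap}(R^{ -1}),\] where $R^{ -1} : B \to A \to \Box_i$ is $R^{ -1}\,b\,a := R\,a\,b$.
   Context: The ambient setting is dependent type theory in the style of the Homotopy Type Theory book (dependent functions $\Pi$, dependent pairs $\Sigma$, the identity type $=$, function extensionality), with universes $\Box_i$. $X \simeq Y$ is the usual (HoTT-book) type of equivalences $\Sigma f : X \to Y.\,\mathrm{isEquiv}(f)$. For $f,g : X \to Y$, $f \doteqdot g := \Pi x.\, f\,x = g\,x$. For $R : A \to B \to \Box_i$, $\mathrm{isUMap}(R)$ is the type $\Sigma (m : A \to B).\,\Sigma (g_1 : \Pi a\,b.\, m\,a = b \to R\,a\,b).\,\Sigma (g_2 : \Pi a\,b.\, R\,a\,b \to m\,a = b).\,\Pi a\,b.\,(g_1\,a\,b)\circ(g_2\,a\,b) \doteqdot id$. -}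

{-# OPTIONS --without-K #-}
module Defs where

open import Level using (Level; _⊔_; suc; Setω)
open import Data.Product using (Σ; Σ-syntax; _×_; _,_; proj₁; proj₂)
open import Relation.Binary.PropositionalEquality using (_≡_; refl)

private variable a b ℓ : Level

isContr : Set a → Set a
isContr X = Σ X λ c → (x : X) → c ≡ x

fib : {X : Set a} {Y : Set b} → (X → Y) → Y → Set (a ⊔ b)
fib {X = X} f y = Σ X λ x → f x ≡ y

isEquiv : {X : Set a} {Y : Set b} → (X → Y) → Set (a ⊔ b)
isEquiv {Y = Y} f = (y : Y) → isContr (fib f y)

_≃_ : Set a → Set b → Set (a ⊔ b)
X ≃ Y = Σ (X → Y) isEquiv
infix 4 _≃_

_≐_ : {X : Set a} {Y : X → Set b} → (f g : (x : X) → Y x) → Set (a ⊔ b)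
f ≐ g = ∀ x → f x ≡ g x
infix 4 _≐_

isUMap : {A : Set a} {B : Set b} → (A → B → Set ℓ) → Set (a ⊔ b ⊔ ℓ)
isUMap {A = A} {B = B} R =
  Σ[ m ∈ (A → B) ]
  Σ[ g₁ ∈ ((a : A) (b : B) → m a ≡ b → R a b) ]
  Σ[ g₂ ∈ ((a : A) (b : B) → R a b → m a ≡ b) ]
  ((a : A) (b : B) → (λ r → g₁ a b (g₂ a b r)) ≐ (λ r → r))

_⁻¹ʳ : {A : Set a} {B : Set b} → (A → B → Set ℓ) → B → A → Set ℓ
(R ⁻¹ʳ) b a = R a b

idtoeqv : {X Y : Set a} → X ≡ Y → X ≃ Y
idtoeqv {X = X} refl = (λ x → x) , λ y → (y , refl) , λ { (x , refl) → refl }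

Univalence : (ℓ : Level) → Set (suc ℓ)
Univalence ℓ = (X Y : Set ℓ) → isEquiv (idtoeqv {X = X} {Y = Y})

FunExt : Setω
FunExt = ∀ {a b} {X : Set a} {Y : X → Set b} {f g : (x : X) → Y x} → f ≐ g → f ≡ g

{-# OPTIONS --safe --without-K #-}

-- If R satisfies isUMap then every Σ b. R a b is a retract of the singleton
-- Σ b. m a ≡ b, hence contractible; conversely such contractibility determines
-- the isUMap structure uniquely, so isUMap R is a proposition.  By the
-- fundamental theorem of identity types R a b ≃ (m a ≡ b), so by univalence R
-- is the graph of m, and isUMap R⁻¹ says precisely that m has contractible
-- fibres.

module Submission where

open import Defs
open import Level using (Level; _⊔_)
open import Data.Product using (Σ; Σ-syntax; _×_; _,_; proj₁; proj₂)
open import Data.Product.Properties using (Σ-≡,≡→≡)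
open import Function.Bundles using (mk↔ₛ′)
open import Function.Properties.Inverse.HalfAdjointEquivalence as HAE using (↔⇒≃)
open import Relation.Binary.PropositionalEquality
  using (_≡_; refl; sym; trans; cong; cong₂; subst; module ≡-Reasoning)
open import Relation.Binary.PropositionalEquality.Properties using (trans-symˡ)

private variable
  ℓ ℓ′ ℓ″ : Level
  X Y : Set ℓ

isProp : Set ℓ → Set ℓ
isProp X = (x y : X) → x ≡ y

isContr→isProp : isContr X → isProp X
isContr→isProp (c , k) x y = trans (sym (k x)) (k y)

isContr→isProp-refl : (cX : isContr X) (x : X) → isContr→isProp cX x x ≡ refl
isContr→isProp-refl (c , k) x = trans-symˡ (k x)

isContr-retract : (s : X → Y) (r : Y → X) → (∀ x → r (s x) ≡ x) → isContr Y → isContr X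
isContr-retract s r rs (c , k) = r c , λ x → trans (cong r (k (s x))) (rs x)

singleton-isContr : (x : X) → isContr (Σ X (x ≡_))
singleton-isContr x = (x , refl) , λ { (y , refl) → refl }

isContr→≡-isContr : isContr X → (x y : X) → isContr (x ≡ y)
isContr→≡-isContr cX x y = isContr→isProp cX x y , λ { refl → isContr→isProp-refl cX x }

Σ-isContr : {P : X → Set ℓ} → isContr X → (∀ x → isContr (P x)) → isContr (Σ X P)
Σ-isContr (c , k) cP = (c , proj₁ (cP c)) ,
  λ (x , p) → Σ-≡,≡→≡ (k x , isContr→isProp (cP x) _ p)

subst-≡ˡ : (f : X → Y) {x x′ : X} {y : Y} (p : x ≡ x′) (q : f x ≡ y) →
           subst (λ z → f z ≡ y) p q ≡ trans (sym (cong f p)) q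
subst-≡ˡ f refl q = refl

halfAdjoint→isEquiv : (e : X HAE.≃ Y) → isEquiv (HAE._≃_.to e)
halfAdjoint→isEquiv e y = (from y , right-inverse-of y) ,
  λ { (x , refl) → Σ-≡,≡→≡ (left-inverse-of x , transported-inverse≡refl x) }
  where
  open HAE._≃_ e
  open ≡-Reasoning

  transported-inverse≡refl : ∀ x →
    subst (λ z → to z ≡ to x) (left-inverse-of x) (right-inverse-of (to x)) ≡ refl
  transported-inverse≡refl x = begin
    subst (λ z → to z ≡ to x) (left-inverse-of x) (right-inverse-of (to x))
      ≡⟨ subst-≡ˡ to (left-inverse-of x) (right-inverse-of (to x)) ⟩
    trans (sym (cong to (left-inverse-of x))) (right-inverse-of (to x))
      ≡⟨ cong (λ p → trans (sym p) (right-inverse-of (to x))) (left-right x) ⟩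
    trans (sym (right-inverse-of (to x))) (right-inverse-of (to x))
      ≡⟨ trans-symˡ (right-inverse-of (to x)) ⟩
    refl ∎

qinv→isEquiv : (f : X → Y) (g : Y → X) →
               (∀ x → g (f x) ≡ x) → (∀ y → f (g y) ≡ y) → isEquiv f
qinv→isEquiv f g gf fg = halfAdjoint→isEquiv (↔⇒≃ (mk↔ₛ′ f g fg gf))

subst-cong-proj₁ : {P : X → Set ℓ} {w w′ : Σ X P} (e : w ≡ w′) →
                   subst P (cong proj₁ e) (proj₂ w) ≡ proj₂ w′
subst-cong-proj₁ refl = refl

subst-≡-based : {Q : X → Set ℓ} {x : X} (g : ∀ y → x ≡ y → Q y) {y : X} (p : x ≡ y) →
                subst Q p (g x refl) ≡ g y p
subst-≡-based g refl = refl

≡-family-isEquiv : {Q : X → Set ℓ} {x : X} → isContr (Σ X Q) →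
                   (g : ∀ y → x ≡ y → Q y) → ∀ y → isEquiv (g y)
≡-family-isEquiv {Q = Q} {x} cQ g y =
  qinv→isEquiv (g y) g⁻¹ g⁻¹∘g g∘g⁻¹
  where
  g⁻¹ : Q y → x ≡ y
  g⁻¹ q = cong proj₁ (isContr→isProp cQ (x , g x refl) (y , q))

  g⁻¹∘g : ∀ p → g⁻¹ (g y p) ≡ p
  g⁻¹∘g refl = cong (cong proj₁) (isContr→isProp-refl cQ (x , g x refl))

  g∘g⁻¹ : ∀ q → g y (g⁻¹ q) ≡ q
  g∘g⁻¹ q = trans (sym (subst-≡-based g (g⁻¹ q)))
                  (subst-cong-proj₁ (isContr→isProp cQ (x , g x refl) (y , q)))

-- isUMap R is (a : A) → IdRetract (R a), up to moving the Π inwards.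
IdRetract : {X : Set ℓ} → (X → Set ℓ′) → Set (ℓ ⊔ ℓ′)
IdRetract {X = X} Q =
  Σ[ x ∈ X ] Σ[ g₁ ∈ (∀ y → x ≡ y → Q y) ] Σ[ g₂ ∈ (∀ y → Q y → x ≡ y) ]
  (∀ y → (λ q → g₁ y (g₂ y q)) ≐ (λ q → q))

IdRetract→isContr-Σ : {Q : X → Set ℓ} → IdRetract Q → isContr (Σ X Q)
IdRetract→isContr-Σ {Q = Q} (x , g₁ , g₂ , g₁∘g₂) =
  isContr-retract (λ (y , q) → y , g₂ y q) (λ (y , p) → y , g₁ y p)
                  (λ (y , q) → cong (y ,_) (g₁∘g₂ y q)) (singleton-isContr x)

isContr-Σ→IdRetract : {Q : X → Set ℓ} → isContr (Σ X Q) → IdRetract Q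
isContr-Σ→IdRetract {Q = Q} ((x , q₀) , k) =
  x , (λ y p → subst Q p q₀) , (λ y q → cong proj₁ (k (y , q))) ,
  (λ y q → subst-cong-proj₁ (k (y , q)))

isUMap-at : {A : Set ℓ} {B : Set ℓ′} {R : A → B → Set ℓ″} →
            isUMap R → (a : A) → IdRetract (R a)
isUMap-at (m , g₁ , g₂ , g₁∘g₂) a = m a , g₁ a , g₂ a , g₁∘g₂ a

isUMap-from : {A : Set ℓ} {B : Set ℓ′} {R : A → B → Set ℓ″} →
              ((a : A) → IdRetract (R a)) → isUMap R
isUMap-from F = (λ a → proj₁ (F a)) , (λ a → proj₁ (proj₂ (F a))) ,
                (λ a → proj₁ (proj₂ (proj₂ (F a)))) , (λ a → proj₂ (proj₂ (proj₂ (F a))))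

isUMap→isContr-Σ : {A : Set ℓ} {B : Set ℓ′} {R : A → B → Set ℓ″} →
                   isUMap R → (a : A) → isContr (Σ B (R a))
isUMap→isContr-Σ u a = IdRetract→isContr-Σ (isUMap-at u a)

isContr-Σ→isUMap : {A : Set ℓ} {B : Set ℓ′} {R : A → B → Set ℓ″} →
                   ((a : A) → isContr (Σ B (R a))) → isUMap R
isContr-Σ→isUMap cR = isUMap-from (λ a → isContr-Σ→IdRetract (cR a))

module _ (funext : FunExt) where

  Π-isContr : {P : X → Set ℓ} → (∀ x → isContr (P x)) → isContr (∀ x → P x)
  Π-isContr cP = (λ x → proj₁ (cP x)) , λ f → funext (λ x → proj₂ (cP x) (f x))

  isContr-isProp : isProp (isContr X)
  isContr-isProp cX = isContr→isProp
    (Σ-isContr cX λ c → Π-isContr λ x → isContr→≡-isContr cX c x) cX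

  isEquiv-isProp : {f : X → Y} → isProp (isEquiv f)
  isEquiv-isProp e e′ = funext λ y → isContr-isProp (e y) (e′ y)

  IdRetract-isContr : {Q : X → Set ℓ} → isContr (Σ X Q) → isContr (IdRetract Q)
  IdRetract-isContr {X = X} {Q = Q} cQ =
    isContr-retract (λ (x , g₁ , g₂ , g₁∘g₂) → (x , g₁) , g₂ , g₁∘g₂)
                    (λ ((x , g₁) , g₂ , g₁∘g₂) → x , g₁ , g₂ , g₁∘g₂)
                    (λ _ → refl)
                    (Σ-isContr based-maps-isContr sections-isContr)
    where
    BasedMap : Set _
    BasedMap = Σ[ x ∈ X ] (∀ y → x ≡ y → Q y)

    Section : BasedMap → Set _
    Section (x , g₁) = Σ[ g₂ ∈ (∀ y → Q y → x ≡ y) ] (∀ y → (λ q → g₁ y (g₂ y q)) ≐ (λ q → q))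

    based-maps-isContr : isContr BasedMap
    based-maps-isContr =
      isContr-retract (λ (x , g₁) → x , g₁ x refl)
                      (λ (x , q) → x , λ y p → subst Q p q)
                      (λ (x , g₁) → cong (x ,_) (funext λ y → funext λ p → subst-≡-based g₁ p))
                      cQ

    sections-isContr : ∀ xg₁ → isContr (Section xg₁)
    sections-isContr (x , g₁) =
      isContr-retract (λ (g₂ , g₁∘g₂) y q → g₂ y q , g₁∘g₂ y q)
                      (λ F → (λ y q → proj₁ (F y q)) , (λ y q → proj₂ (F y q)))
                      (λ _ → refl)
                      (Π-isContr λ y → Π-isContr λ q → ≡-family-isEquiv cQ g₁ y q)

  isUMap-isProp : {A : Set ℓ} {B : Set ℓ′} {R : A → B → Set ℓ″} → isProp (isUMap R)
  isUMap-isProp u = isContr→isProp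
    (isContr-retract isUMap-at isUMap-from (λ _ → refl)
                     (Π-isContr λ a → IdRetract-isContr (isUMap→isContr-Σ u a)))
    u

  module _ {i : Level} (univalence : Univalence i) (A B : Set i) where

    Correspondence : Set (Level.suc i)
    Correspondence = Σ[ R ∈ (A → B → Set i) ] (isUMap R × isUMap (R ⁻¹ʳ))

    ua : {X Y : Set i} → X ≃ Y → X ≡ Y
    ua {X} {Y} e = proj₁ (proj₁ (univalence X Y e))

    -- The fibres of f are definitionally the total spaces Σ a. graph⁻¹ b a.
    graph : A ≃ B → Correspondence
    graph (f , f-isEquiv) = (λ a b → f a ≡ b) ,
      isContr-Σ→isUMap (λ a → singleton-isContr (f a)) , isContr-Σ→isUMap f-isEquiv

    correspondence→equiv : Correspondence → A ≃ B
    correspondence→equiv (R , (m , g₁ , g₂ , _) , (m′ , g₁′ , g₂′ , _)) =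
      m , qinv→isEquiv m m′ (λ a → g₂′ (m a) a (g₁ a (m a) refl))
                            (λ b → g₂ (m′ b) b (g₁′ b (m′ b) refl))

    correspondence→equiv∘graph : ∀ e → correspondence→equiv (graph e) ≡ e
    correspondence→equiv∘graph (f , f-isEquiv) = cong (f ,_) (isEquiv-isProp _ _)

    graph∘correspondence→equiv : ∀ c → graph (correspondence→equiv c) ≡ c
    graph∘correspondence→equiv (R , u , u′) =
      Σ-≡,≡→≡ (graph≡R , cong₂ _,_ (isUMap-isProp _ u) (isUMap-isProp _ u′))
      where
      graph≡R : (λ a b → proj₁ u a ≡ b) ≡ R
      graph≡R = funext λ a → funext λ b →
        ua (proj₁ (proj₂ u) a b , ≡-family-isEquiv (isUMap→isContr-Σ u a) (proj₁ (proj₂ u) a) b)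

    graph-isEquiv : isEquiv graph
    graph-isEquiv = qinv→isEquiv graph correspondence→equiv
                      correspondence→equiv∘graph graph∘correspondence→equiv

theorem3 : FunExt → {i : Level} → Univalence i → (A B : Set i) →
           (A ≃ B) ≃ (Σ[ R ∈ (A → B → Set i) ] (isUMap R × isUMap (R ⁻¹ʳ)))
theorem3 funext univalence A B = graph funext univalence A B , graph-isEquiv funext univalence A B
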